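{- Let $q_1,\ldots,q_k$ be prime powers with $q_i \ge 3$ for $1 \le i \le k$, and let $R \cong F_{q_1}\times F_{q_2}\times\cdots\times F_{q_k}$, where $F_q$ denotes the finite field with $q$ elements. Then the zero-divisor graph $\Gamma(R)$ is $A$-vertex magic for every Abelian group $A$ with $|A|>2$.
   Context: For a commutative ring $R$, a zero-divisor is a non-zero element $u$ such that $uv=0$ for some non-zero $v\in R$; $Z(R)$ is the set of zero-divisors. The zero-divisor graph $\Gamma(R)$ has vertex set $Z(R)$, with distinct $u,v$ adjacent iff $uv=0$. For a non-trivial Abelian group $A$, a graph $G$ is $A$-vertex magic if there exist a labeling $l : V(G) \to A\setminus\{0\}$ and $\mu \in A$ such that $\sum_{u \in N_G(v)} l(u) = \mu$ for every $v \in V(G)$, where $N_G(v)$ is the open neighborhood of $v$. -}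

module Defs where

open import Level using (Level; _⊔_)
open import Data.Nat using (ℕ; suc; _^_)
open import Data.Nat.Primality using (Prime)
open import Data.Fin using (Fin)
open import Data.List using (List; map; foldr)
open import Data.List.Relation.Unary.Any using (Any)
open import Data.List.Relation.Unary.All using (All)
open import Data.List.Relation.Unary.AllPairs using (AllPairs)
open import Data.Product using (Σ; ∃; ∃-syntax; _×_)
open import Relation.Nullary using (¬_)
open import Relation.Binary.PropositionalEquality using (_≡_)
open import Algebra.Bundles using (CommutativeRing; AbelianGroup)

private
  variable
    c ℓ c' ℓ' a ℓa : Level

IsPrimePower : ℕ → Set
IsPrimePower q = ∃[ p ] ∃[ m ] (Prime p × q ≡ p ^ suc m)

IsField : CommutativeRing c ℓ → Set (c ⊔ ℓ)
IsField F = ¬ (0# ≈ 1#) × (∀ x → ¬ (x ≈ 0#) → ∃[ y ] (x * y ≈ 1#))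
  where open CommutativeRing F

HasCardinality : CommutativeRing c ℓ → ℕ → Set (c ⊔ ℓ)
HasCardinality F q =
  Σ (Fin q → Carrier) λ e →
    (∀ i j → e i ≈ e j → i ≡ j) × (∀ x → ∃[ i ] (e i ≈ x))
  where open CommutativeRing F

IsRingIsoToProduct : (R : CommutativeRing c ℓ) {k : ℕ}
  (F : Fin k → CommutativeRing c' ℓ') →
  (CommutativeRing.Carrier R → (i : Fin k) → CommutativeRing.Carrier (F i)) →
  Set (c ⊔ ℓ ⊔ c' ⊔ ℓ')
IsRingIsoToProduct R {k} F φ =
    (∀ x y → x ≈ y → ∀ i → F._≈_ i (φ x i) (φ y i))
  × (∀ x y i → F._≈_ i (φ (x + y) i) (F._+_ i (φ x i) (φ y i)))
  × (∀ x y i → F._≈_ i (φ (x * y) i) (F._*_ i (φ x i) (φ y i)))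
  × (∀ i → F._≈_ i (φ 1# i) (F.1# i))
  × (∀ x y → (∀ i → F._≈_ i (φ x i) (φ y i)) → x ≈ y)
  × (∀ (t : (i : Fin k) → F.Carrier i) → ∃[ x ] (∀ i → F._≈_ i (φ x i) (t i)))
  where
    open CommutativeRing R
    module F i = CommutativeRing (F i)

module _ (R : CommutativeRing c ℓ) where
  open CommutativeRing R

  IsZeroDivisor : Carrier → Set (c ⊔ ℓ)
  IsZeroDivisor u = ¬ (u ≈ 0#) × ∃[ v ] (¬ (v ≈ 0#) × u * v ≈ 0#)

  InNeighbourhood : Carrier → Carrier → Set (c ⊔ ℓ)
  InNeighbourhood v u = IsZeroDivisor u × ¬ (u ≈ v) × u * v ≈ 0#

  module _ (A : AbelianGroup a ℓa) where
    private module A = AbelianGroup A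

    -- Since A is abelian the sum does not depend on the enumeration.
    SumOverIs : (Carrier → Set (c ⊔ ℓ)) → (Carrier → A.Carrier) → A.Carrier → Set (c ⊔ ℓ ⊔ ℓa)
    SumOverIs S l μ = ∃[ xs ]
        ( All S xs
        × (∀ x → S x → Any (x ≈_) xs)
        × AllPairs (λ x y → ¬ (x ≈ y)) xs
        × foldr A._∙_ A.ε (map l xs) A.≈ μ )

    -- Γ(R) is A-vertex magic: a labeling l : Z(R) → A ∖ {0} (well defined on
    -- ≈-classes; values outside Z(R) are irrelevant) and μ ∈ A such that the
    -- labels over the open neighbourhood of every vertex sum to μ.
    IsVertexMagicZDG : Set (c ⊔ ℓ ⊔ a ⊔ ℓa)
    IsVertexMagicZDG = ∃[ l ]
        ( (∀ x y → x ≈ y → l x A.≈ l y)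
        × (∀ u → IsZeroDivisor u → ¬ (l u A.≈ A.ε))
        × ∃[ μ ] (∀ v → IsZeroDivisor v → SumOverIs (InNeighbourhood v) l μ) )

MoreThanTwoElements : AbelianGroup a ℓa → Set (a ⊔ ℓa)
MoreThanTwoElements A =
  ∃[ x ] ∃[ y ] ∃[ z ] (¬ (x ≈ y) × ¬ (x ≈ z) × ¬ (y ≈ z))
  where open AbelianGroup A

-- Write R ≅ F₀ × ⋯ × F_{k-1}. The neighbours of a zero-divisor v in Γ(R) are exactly the non-zero
-- elements supported on the coordinates where v vanishes. Because |F_i| − 1 ≥ 2 and |A| > 2, the
-- non-zero elements of each F_i can be labelled by non-zero elements of A summing to ε: pairs a, a⁻¹,
-- plus one triple a, b, (a ∙ b)⁻¹ with a, b, a ∙ b ≠ ε when |F_i| − 1 is odd. Label u ∈ R by the label of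
-- its first non-zero coordinate. Grouping the neighbours of v by their first non-zero coordinate i and
-- the coordinates after it, each group runs once over the non-zero elements of F_i and so sums to ε;
-- hence every open neighbourhood sums to μ = ε.
module Submission where

open import Level using (Level; _⊔_)
open import Function using (_∘_; flip)
open import Data.Empty using (⊥-elim)
open import Data.Unit using (⊤; tt)
open import Data.Product using (Σ-syntax; ∃-syntax; _×_; _,_; proj₁; proj₂; swap)
open import Data.Product.Properties using (×-≡,≡←≡)
open import Data.Sum using (_⊎_; inj₁; inj₂; [_,_]′)
open import Data.Nat using (ℕ; zero; suc; _≤_)
open import Data.Nat.Properties using (m≤n⇒∃[o]m+o≡n)
open import Data.Fin using (Fin; zero; suc; _≟_)
open import Data.Fin.Properties using (suc-injective)
open import Data.Fin.Permutation.Components using (transpose; transpose-inverse)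
open import Data.Vec.Functional using (Vector)
open import Data.List using (List; []; _∷_; _++_; map; foldr; tabulate; cartesianProductWith)
open import Data.List.Properties using (map-∘; map-cong)
open import Data.List.Membership.Propositional using (_∈_)
open import Data.List.Membership.Propositional.Properties
  using (∈-map⁺; ∈-map⁻; ∈-++⁺ˡ; ∈-++⁺ʳ; ∈-++⁻; ∈-tabulate⁺; ∈-tabulate⁻;
         ∈-cartesianProductWith⁺; ∈-cartesianProductWith⁻)
open import Data.List.Relation.Unary.All using (All)
import Data.List.Relation.Unary.All as All
import Data.List.Relation.Unary.All.Properties as All
open import Data.List.Relation.Unary.Any using (Any; here; there)
import Data.List.Relation.Unary.Any as Any
open import Data.List.Relation.Unary.AllPairs using (AllPairs; []; _∷_)
open import Data.List.Relation.Unary.Unique.Propositional using (Unique)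
import Data.List.Relation.Unary.Unique.Propositional.Properties as Unique
import Data.List.Relation.Unary.Unique.Setoid.Properties as Uniqueₛ
open import Data.List.Relation.Binary.Disjoint.Propositional using (Disjoint)
open import Relation.Nullary using (¬_; Dec; yes; no)
open import Relation.Nullary.Decidable using (map′)
open import Relation.Unary using (Pred; Decidable)
open import Relation.Binary.PropositionalEquality using (_≡_; _≢_; refl; cong; cong₂)
import Relation.Binary.PropositionalEquality as ≡
open import Algebra.Bundles using (Monoid; AbelianGroup; CommutativeRing)

open import Defs

private
  variable
    p : Level
    k : ℕ
    n : Fin k → ℕ

-- A point of F₀ × ⋯ × F_{k-1}, where F_i has n i non-zero elements: coordinate i is zero for 0 and
-- suc b for the b-th non-zero element of F_i.
Coords : (k : ℕ) → (Fin k → ℕ) → Set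
Coords zero    n = ⊤
Coords (suc k) n = Fin (suc (n zero)) × Coords k (n ∘ suc)

lookupᶜ : Coords k n → (i : Fin k) → Fin (suc (n i))
lookupᶜ {k = suc k} (a , τ) zero    = a
lookupᶜ {k = suc k} (a , τ) (suc i) = lookupᶜ τ i

tabulateᶜ : ((i : Fin k) → Fin (suc (n i))) → Coords k n
tabulateᶜ {k = zero}  f = tt
tabulateᶜ {k = suc k} f = f zero , tabulateᶜ (λ i → f (suc i))

lookup-tabulateᶜ : (f : (i : Fin k) → Fin (suc (n i))) → ∀ i → lookupᶜ (tabulateᶜ f) i ≡ f i
lookup-tabulateᶜ f zero    = refl
lookup-tabulateᶜ f (suc i) = lookup-tabulateᶜ (λ i → f (suc i)) i

tabulate-lookupᶜ : (τ : Coords k n) → tabulateᶜ (lookupᶜ τ) ≡ τ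
tabulate-lookupᶜ {k = zero}  tt      = refl
tabulate-lookupᶜ {k = suc k} (a , τ) = cong (a ,_) (tabulate-lookupᶜ τ)

tabulateᶜ-cong : {f g : (i : Fin k) → Fin (suc (n i))} → (∀ i → f i ≡ g i) → tabulateᶜ f ≡ tabulateᶜ g
tabulateᶜ-cong {k = zero}  f≗g = refl
tabulateᶜ-cong {k = suc k} f≗g = cong₂ _,_ (f≗g zero) (tabulateᶜ-cong (λ i → f≗g (suc i)))

0ᶜ : Coords k n
0ᶜ = tabulateᶜ (λ _ → zero)

Supported : Pred (Fin k) p → Coords k n → Set p
Supported P τ = ∀ i → ¬ P i → lookupᶜ τ i ≡ zero

nonzeroValues : {A : Set p} → Dec A → (m : ℕ) → List (Fin (suc m))
nonzeroValues (yes _) m = tabulate suc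
nonzeroValues (no _)  m = []

-- The tuples with non-zero head are grouped by tail, each group running once over the non-zero heads.
nonzeroSupported : {P : Pred (Fin k) p} → Decidable P → List (Coords k n)
nonzeroSupported {k = zero}          P? = []
nonzeroSupported {k = suc k} {n = n} P? =
  map (zero ,_) rest ++ cartesianProductWith (flip _,_) (0ᶜ ∷ rest) (nonzeroValues (P? zero) (n zero))
  where
    rest : List (Coords k (n ∘ suc))
    rest = nonzeroSupported (P? ∘ suc)

module _ {A : Set p} where

  ∈-nonzeroValues⁻ : (a? : Dec A) {m : ℕ} {b : Fin (suc m)} → b ∈ nonzeroValues a? m → A × b ≢ zero
  ∈-nonzeroValues⁻ (yes a) b∈ with _ , refl ← ∈-tabulate⁻ b∈ = a , λ ()

  ∈-nonzeroValues⁺ : (a? : Dec A) {m : ℕ} {b : Fin m} → (¬ A → suc b ≡ zero) → suc b ∈ nonzeroValues a? m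
  ∈-nonzeroValues⁺ (yes _)  _    = ∈-tabulate⁺ _
  ∈-nonzeroValues⁺ (no ¬a)  b≡0 with () ← b≡0 ¬a

  nonzeroValues-unique : (a? : Dec A) (m : ℕ) → Unique (nonzeroValues a? m)
  nonzeroValues-unique (yes _) m = Unique.tabulate⁺ suc-injective
  nonzeroValues-unique (no _)  m = []

module _ {P : Pred (Fin (suc k)) p} {n : Fin (suc k) → ℕ} where

  supported-, : ∀ {a τ} → (¬ P zero → a ≡ zero) → Supported (P ∘ suc) τ → Supported {n = n} P (a , τ)
  supported-, a≡0 τ-sup zero    = a≡0
  supported-, a≡0 τ-sup (suc i) = τ-sup i

0ᶜ-supported : {P : Pred (Fin k) p} → Supported {n = n} P 0ᶜ
0ᶜ-supported i _ = lookup-tabulateᶜ _ i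

∈-nonzeroSupported⁻ : {P : Pred (Fin k) p} (P? : Decidable P) {τ : Coords k n} →
  τ ∈ nonzeroSupported P? → Supported P τ × τ ≢ 0ᶜ
∈-nonzeroSupported⁻ {k = suc k} {n = n} {P = P} P? τ∈
  with ∈-++⁻ (map (zero ,_) (nonzeroSupported {n = n ∘ suc} (P? ∘ suc))) τ∈
... | inj₁ τ∈₁ with _ , τ′∈ , refl ← ∈-map⁻ (zero ,_) τ∈₁ =
  let τ′-sup , τ′≢0 = ∈-nonzeroSupported⁻ (P? ∘ suc) τ′∈ in
  supported-, (λ _ → refl) τ′-sup , τ′≢0 ∘ cong proj₂
... | inj₂ τ∈₂
  with _ , _ , τ′∈ , b∈ , refl ← ∈-cartesianProductWith⁻ (flip _,_) (0ᶜ ∷ nonzeroSupported (P? ∘ suc)) _ τ∈₂ =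
  let P₀ , b≢0 = ∈-nonzeroValues⁻ (P? zero) b∈ in
  supported-, (λ ¬P₀ → ⊥-elim (¬P₀ P₀)) (tail-supported τ′∈) , b≢0 ∘ cong proj₁
  where
    rest : List (Coords k (n ∘ suc))
    rest = nonzeroSupported (P? ∘ suc)
    tail-supported : ∀ {τ} → τ ∈ 0ᶜ ∷ rest → Supported (P ∘ suc) τ
    tail-supported (here refl) = 0ᶜ-supported
    tail-supported (there τ∈)  = proj₁ (∈-nonzeroSupported⁻ (P? ∘ suc) τ∈)

nonzeroSupported-complete : {P : Pred (Fin k) p} (P? : Decidable P) (τ : Coords k n) →
  Supported P τ → τ ∈ 0ᶜ ∷ nonzeroSupported P?
nonzeroSupported-complete {k = zero}  P? tt          _     = here refl
nonzeroSupported-complete {k = suc k} P? (zero , τ)  τ-sup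
  with nonzeroSupported-complete (P? ∘ suc) τ (τ-sup ∘ suc)
... | here refl = here refl
... | there τ∈  = there (∈-++⁺ˡ (∈-map⁺ (zero ,_) τ∈))
nonzeroSupported-complete {k = suc k} {n = n} P? (suc b , τ) τ-sup =
  there (∈-++⁺ʳ (map (zero ,_) (nonzeroSupported {n = n ∘ suc} (P? ∘ suc)))
    (∈-cartesianProductWith⁺ (flip _,_)
      (nonzeroSupported-complete (P? ∘ suc) τ (τ-sup ∘ suc))
      (∈-nonzeroValues⁺ (P? zero) (τ-sup zero))))

nonzeroSupported-unique : {P : Pred (Fin k) p} (P? : Decidable P) → Unique (nonzeroSupported {n = n} P?)
nonzeroSupported-unique {k = zero}          P? = []
nonzeroSupported-unique {k = suc k} {n = n} P? =
  Unique.++⁺ (Unique.map⁺ (cong proj₂) rest!)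
    (Unique.cartesianProductWith⁺ (flip _,_) (swap ∘ ×-≡,≡←≡)
      (All.tabulate (λ τ∈ → proj₂ (∈-nonzeroSupported⁻ (P? ∘ suc) τ∈) ∘ ≡.sym) ∷ rest!)
      (nonzeroValues-unique (P? zero) (n zero)))
    heads-differ
  where
    rest : List (Coords k (n ∘ suc))
    rest = nonzeroSupported (P? ∘ suc)
    rest! : Unique rest
    rest! = nonzeroSupported-unique (P? ∘ suc)
    heads-differ : Disjoint (map (zero ,_) rest)
                            (cartesianProductWith (flip _,_) (0ᶜ ∷ rest) (nonzeroValues (P? zero) (n zero)))
    heads-differ (τ∈₁ , τ∈₂) with ∈-map⁻ (zero ,_) τ∈₁ | ∈-cartesianProductWith⁻ (flip _,_) (0ᶜ ∷ rest) _ τ∈₂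
    ... | _ , _ , refl | _ , _ , _ , b∈ , eq = proj₂ (∈-nonzeroValues⁻ (P? zero) b∈) (≡.sym (cong proj₁ eq))

module FirstNonzeroLabelling {c ℓ} (M : Monoid c ℓ) where
  open Monoid M renaming (refl to ≈-refl)
  open import Algebra.Definitions.RawMonoid rawMonoid using (sum)
  open import Relation.Binary.Reasoning.Setoid setoid

  ∑ : ∀ {x} {X : Set x} → (X → Carrier) → List X → Carrier
  ∑ f xs = foldr _∙_ ε (map f xs)

  ∑-++ : ∀ {x} {X : Set x} (f : X → Carrier) (xs ys : List X) → ∑ f (xs ++ ys) ≈ ∑ f xs ∙ ∑ f ys
  ∑-++ f []       ys = sym (identityˡ _)
  ∑-++ f (x ∷ xs) ys = trans (∙-congˡ (∑-++ f xs ys)) (sym (assoc _ _ _))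

  ∑-map : ∀ {x y} {X : Set x} {Y : Set y} (f : Y → Carrier) (g : X → Y) (xs : List X) →
    ∑ f (map g xs) ≡ ∑ (f ∘ g) xs
  ∑-map f g xs = cong (foldr _∙_ ε) (≡.sym (map-∘ xs))

  ∑-tabulate : ∀ {x} {X : Set x} {m : ℕ} (f : X → Carrier) (t : Fin m → X) → ∑ f (tabulate t) ≡ sum (f ∘ t)
  ∑-tabulate {m = zero}  f t = refl
  ∑-tabulate {m = suc m} f t = cong (f (t zero) ∙_) (∑-tabulate f (t ∘ suc))

  ∑-cartesianProductWith : ∀ {x y z} {X : Set x} {Y : Set y} {Z : Set z}
    (f : Z → Carrier) (g : X → Y → Z) {ys : List Y} →
    (∀ x → ∑ (f ∘ g x) ys ≈ ε) → ∀ xs → ∑ f (cartesianProductWith g xs ys) ≈ ε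
  ∑-cartesianProductWith f g         rows []       = ≈-refl
  ∑-cartesianProductWith f g {ys} rows (x ∷ xs) = begin
    ∑ f (map (g x) ys ++ cartesianProductWith g xs ys)     ≈⟨ ∑-++ f (map (g x) ys) _ ⟩
    ∑ f (map (g x) ys) ∙ ∑ f (cartesianProductWith g xs ys) ≡⟨ cong (_∙ _) (∑-map f (g x) ys) ⟩
    ∑ (f ∘ g x) ys ∙ ∑ f (cartesianProductWith g xs ys)     ≈⟨ ∙-cong (rows x) (∑-cartesianProductWith f g rows xs) ⟩
    ε ∙ ε                                                   ≈⟨ identityˡ ε ⟩
    ε                                                       ∎

  firstNonzeroLabel : ((i : Fin k) → Fin (n i) → Carrier) → Coords k n → Carrier
  firstNonzeroLabel {k = zero}  g tt          = ε
  firstNonzeroLabel {k = suc k} g (zero , τ)  = firstNonzeroLabel (g ∘ suc) τ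
  firstNonzeroLabel {k = suc k} g (suc b , τ) = g zero b

  firstNonzeroLabel-≉ε : {g : (i : Fin k) → Fin (n i) → Carrier} → (∀ i b → g i b ≉ ε) →
    ∀ τ → τ ≢ 0ᶜ → firstNonzeroLabel g τ ≉ ε
  firstNonzeroLabel-≉ε {k = zero}  g≉ε tt          τ≢0 = ⊥-elim (τ≢0 refl)
  firstNonzeroLabel-≉ε {k = suc k} g≉ε (zero , τ)  τ≢0 = firstNonzeroLabel-≉ε (g≉ε ∘ suc) τ (τ≢0 ∘ cong (zero ,_))
  firstNonzeroLabel-≉ε {k = suc k} g≉ε (suc b , τ) τ≢0 = g≉ε zero b

  ∑-nonzeroValues : {A : Set p} (a? : Dec A) {m : ℕ} (f : Fin (suc m) → Carrier) →
    sum (f ∘ suc) ≈ ε → ∑ f (nonzeroValues a? m) ≈ ε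
  ∑-nonzeroValues (yes _) f Σ≈ε = trans (reflexive (∑-tabulate f suc)) Σ≈ε
  ∑-nonzeroValues (no _)  f Σ≈ε = ≈-refl

  ∑-firstNonzeroLabel : {g : (i : Fin k) → Fin (n i) → Carrier} → (∀ i → sum (g i) ≈ ε) →
    {P : Pred (Fin k) p} (P? : Decidable P) → ∑ (firstNonzeroLabel g) (nonzeroSupported P?) ≈ ε
  ∑-firstNonzeroLabel {k = zero}                  Σg≈ε P? = ≈-refl
  ∑-firstNonzeroLabel {k = suc k} {n = n} {g = g} Σg≈ε P? = begin
    ∑ L (map (zero ,_) rest ++ blocks)     ≈⟨ ∑-++ L (map (zero ,_) rest) blocks ⟩
    ∑ L (map (zero ,_) rest) ∙ ∑ L blocks  ≡⟨ cong (_∙ ∑ L blocks) (∑-map L (zero ,_) rest) ⟩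
    ∑ (firstNonzeroLabel (g ∘ suc)) rest ∙ ∑ L blocks
      ≈⟨ ∙-cong (∑-firstNonzeroLabel (Σg≈ε ∘ suc) (P? ∘ suc)) ∑-blocks ⟩
    ε ∙ ε                                  ≈⟨ identityˡ ε ⟩
    ε                                      ∎
    where
      L : Coords (suc k) n → Carrier
      L = firstNonzeroLabel g
      rest : List (Coords k (n ∘ suc))
      rest = nonzeroSupported (P? ∘ suc)
      heads : List (Fin (suc (n zero)))
      heads = nonzeroValues (P? zero) (n zero)
      blocks : List (Coords (suc k) n)
      blocks = cartesianProductWith (flip _,_) (0ᶜ ∷ rest) heads
      ∑-blocks : ∑ L blocks ≈ ε
      ∑-blocks = ∑-cartesianProductWith L (flip _,_) {heads}
        (λ τ → ∑-nonzeroValues (P? zero) (L ∘ (_, τ)) (Σg≈ε zero)) (0ᶜ ∷ rest)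

ZeroSumLabelling : ∀ {c ℓ} → AbelianGroup c ℓ → ℕ → Set (c ⊔ ℓ)
ZeroSumLabelling A m = Σ[ g ∈ Vector Carrier m ] (∀ i → g i ≉ ε) × sum g ≈ ε
  where
    open AbelianGroup A
    open import Algebra.Definitions.RawMonoid rawMonoid using (sum)

module ZeroSumVectors {c ℓ} (A : AbelianGroup c ℓ) where
  open AbelianGroup A
  open import Algebra.Properties.Group group using (ε⁻¹≈ε; ⁻¹-injective; x∙y⁻¹≈ε⇒x≈y; \\-leftDividesˡ; \\-leftDividesʳ)
  open import Algebra.Definitions.RawMonoid rawMonoid using (sum)

  ⁻¹-≉ε : ∀ {x} → x ≉ ε → x ⁻¹ ≉ ε
  ⁻¹-≉ε x≉ε x⁻¹≈ε = x≉ε (⁻¹-injective (trans x⁻¹≈ε (sym ε⁻¹≈ε)))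

  moreThanTwoElements⇒≉ε-pair : MoreThanTwoElements A → ∃[ a ] ∃[ b ] (a ≉ ε × b ≉ ε × a ∙ b ≉ ε)
  moreThanTwoElements⇒≉ε-pair (x , y , z , x≉y , x≉z , y≉z) =
    x ∙ y ⁻¹ , y ∙ z ⁻¹ , x≉y ∘ x∙y⁻¹≈ε⇒x≈y x y , y≉z ∘ x∙y⁻¹≈ε⇒x≈y y z ,
    x≉z ∘ x∙y⁻¹≈ε⇒x≈y x z ∘ trans (sym telescope)
    where
      telescope : (x ∙ y ⁻¹) ∙ (y ∙ z ⁻¹) ≈ x ∙ z ⁻¹
      telescope = trans (assoc x (y ⁻¹) (y ∙ z ⁻¹)) (∙-congˡ (\\-leftDividesʳ y (z ⁻¹)))

  zeroSumVector : Carrier → Carrier → (m : ℕ) → Vector Carrier (suc (suc m))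
  zeroSumVector a b zero          zero             = a
  zeroSumVector a b zero          (suc zero)       = a ⁻¹
  zeroSumVector a b (suc zero)    zero             = a
  zeroSumVector a b (suc zero)    (suc zero)       = b
  zeroSumVector a b (suc zero)    (suc (suc zero)) = (a ∙ b) ⁻¹
  zeroSumVector a b (suc (suc m)) zero             = a
  zeroSumVector a b (suc (suc m)) (suc zero)       = a ⁻¹
  zeroSumVector a b (suc (suc m)) (suc (suc i))    = zeroSumVector a b m i

  sum-zeroSumVector : ∀ a b m → sum (zeroSumVector a b m) ≈ ε
  sum-zeroSumVector a b zero          = \\-leftDividesˡ a ε
  sum-zeroSumVector a b (suc zero)    = trans (sym (assoc a b _)) (\\-leftDividesˡ (a ∙ b) ε)
  sum-zeroSumVector a b (suc (suc m)) = trans (\\-leftDividesˡ a _) (sum-zeroSumVector a b m)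

  zeroSumVector-≉ε : ∀ {a b} → a ≉ ε → b ≉ ε → a ∙ b ≉ ε → ∀ m i → zeroSumVector a b m i ≉ ε
  zeroSumVector-≉ε a≉ε b≉ε ab≉ε zero          zero                = a≉ε
  zeroSumVector-≉ε a≉ε b≉ε ab≉ε zero          (suc zero)          = ⁻¹-≉ε a≉ε
  zeroSumVector-≉ε a≉ε b≉ε ab≉ε (suc zero)    zero                = a≉ε
  zeroSumVector-≉ε a≉ε b≉ε ab≉ε (suc zero)    (suc zero)          = b≉ε
  zeroSumVector-≉ε a≉ε b≉ε ab≉ε (suc zero)    (suc (suc zero))    = ⁻¹-≉ε ab≉ε
  zeroSumVector-≉ε a≉ε b≉ε ab≉ε (suc (suc m)) zero                = a≉ε
  zeroSumVector-≉ε a≉ε b≉ε ab≉ε (suc (suc m)) (suc zero)          = ⁻¹-≉ε a≉ε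
  zeroSumVector-≉ε a≉ε b≉ε ab≉ε (suc (suc m)) (suc (suc i))       = zeroSumVector-≉ε a≉ε b≉ε ab≉ε m i

  zeroSumLabelling : MoreThanTwoElements A → ∀ m → ZeroSumLabelling A (suc (suc m))
  zeroSumLabelling A>2 m with a , b , a≉ε , b≉ε , ab≉ε ← moreThanTwoElements⇒≉ε-pair A>2 =
    zeroSumVector a b m , zeroSumVector-≉ε a≉ε b≉ε ab≉ε m , sum-zeroSumVector a b m

record ZeroFirstEnumeration {c ℓ} (F : CommutativeRing c ℓ) (m : ℕ) : Set (c ⊔ ℓ) where
  open CommutativeRing F hiding (zero)
  field
    enum            : Fin (suc m) → Carrier
    enum-injective  : ∀ a b → enum a ≈ enum b → a ≡ b
    enum-surjective : ∀ x → ∃[ a ] enum a ≈ x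
    enum-zero       : enum zero ≈ 0#

  index : Carrier → Fin (suc m)
  index x = proj₁ (enum-surjective x)

  enum-index : ∀ x → enum (index x) ≈ x
  enum-index x = proj₂ (enum-surjective x)

  index-cong : ∀ {x y} → x ≈ y → index x ≡ index y
  index-cong {x} {y} x≈y = enum-injective _ _ (trans (enum-index x) (trans x≈y (sym (enum-index y))))

  index-enum : ∀ a → index (enum a) ≡ a
  index-enum a = enum-injective _ _ (enum-index (enum a))

  index-zero : ∀ {x} → x ≈ 0# → index x ≡ zero
  index-zero x≈0 = ≡.trans (index-cong (trans x≈0 (sym enum-zero))) (index-enum zero)

  ≈0? : Decidable (_≈ 0#)
  ≈0? x = map′ (λ i≡0 → trans (sym (enum-index x)) (trans (reflexive (cong enum i≡0)) enum-zero))
               index-zero (index x ≟ zero)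

zeroFirst : ∀ {c ℓ} {F : CommutativeRing c ℓ} {m} → HasCardinality F (suc m) → ZeroFirstEnumeration F m
zeroFirst {F = F} {m} (e , e-injective , e-surjective) = record
  { enum            = e ∘ transpose zero z
  ; enum-injective  = λ a b ea≈eb → ≡.trans (≡.sym (transpose-inverse z zero))
                        (≡.trans (cong (transpose z zero) (e-injective _ _ ea≈eb)) (transpose-inverse z zero))
  ; enum-surjective = λ x → transpose z zero (proj₁ (e-surjective x)) ,
                        trans (reflexive (cong e (transpose-inverse zero z))) (proj₂ (e-surjective x))
  ; enum-zero       = proj₂ (e-surjective 0#)
  }
  where
    open CommutativeRing F hiding (zero)
    z : Fin (suc m)
    z = proj₁ (e-surjective 0#)

x*y≈0⇒x≈0 : ∀ {c ℓ} (F : CommutativeRing c ℓ) → IsField F → let open CommutativeRing F in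
  ∀ {x y} → x * y ≈ 0# → ¬ y ≈ 0# → x ≈ 0#
x*y≈0⇒x≈0 F (_ , inverse) {x} {y} xy≈0 y≉0 with y⁻¹ , yy⁻¹≈1 ← inverse y y≉0 = begin
  x              ≈⟨ *-identityʳ x ⟨
  x * 1#         ≈⟨ *-congˡ yy⁻¹≈1 ⟨
  x * (y * y⁻¹)  ≈⟨ *-assoc x y y⁻¹ ⟨
  (x * y) * y⁻¹  ≈⟨ *-congʳ xy≈0 ⟩
  0# * y⁻¹       ≈⟨ zeroˡ y⁻¹ ⟩
  0#             ∎
  where
    open CommutativeRing F
    open import Relation.Binary.Reasoning.Setoid setoid

module ProductOfFields
  {c ℓ c' ℓ' : Level} {k : ℕ}
  (F : Fin k → CommutativeRing c' ℓ') (F-isField : ∀ i → IsField (F i))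
  {n : Fin k → ℕ} (E : ∀ i → ZeroFirstEnumeration (F i) (n i))
  (R : CommutativeRing c ℓ) (φ : CommutativeRing.Carrier R → (i : Fin k) → CommutativeRing.Carrier (F i))
  (φ-iso : IsRingIsoToProduct R F φ)
  where

  open CommutativeRing R hiding (zero)
  module F i = CommutativeRing (F i)
  module E i = ZeroFirstEnumeration (E i)

  private
    φ-cong : ∀ x y → x ≈ y → ∀ i → F._≈_ i (φ x i) (φ y i)
    φ-cong = proj₁ φ-iso

    φ-+ : ∀ x y i → F._≈_ i (φ (x + y) i) (F._+_ i (φ x i) (φ y i))
    φ-+ = proj₁ (proj₂ φ-iso)

    φ-* : ∀ x y i → F._≈_ i (φ (x * y) i) (F._*_ i (φ x i) (φ y i))
    φ-* = proj₁ (proj₂ (proj₂ φ-iso))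

    φ-injective : ∀ x y → (∀ i → F._≈_ i (φ x i) (φ y i)) → x ≈ y
    φ-injective = proj₁ (proj₂ (proj₂ (proj₂ (proj₂ φ-iso))))

    φ-surjective : ∀ (t : (i : Fin k) → F.Carrier i) → ∃[ x ] (∀ i → F._≈_ i (φ x i) (t i))
    φ-surjective = proj₂ (proj₂ (proj₂ (proj₂ (proj₂ φ-iso))))

  VanishesAt : Carrier → Fin k → Set ℓ'
  VanishesAt u i = F._≈_ i (φ u i) (F.0# i)

  φ-0# : ∀ i → VanishesAt 0# i
  φ-0# i = identityˡ-unique (φ 0# i) (φ 0# i) (F.trans i (F.sym i (φ-+ 0# 0# i)) (φ-cong _ _ (+-identityʳ 0#) i))
    where open import Algebra.Properties.Group (F.+-group i) using (identityˡ-unique)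

  vanishesEverywhere⇒≈0# : ∀ {u} → (∀ i → VanishesAt u i) → u ≈ 0#
  vanishesEverywhere⇒≈0# φu≈0 = φ-injective _ _ (λ i → F.trans i (φu≈0 i) (F.sym i (φ-0# i)))

  coords : Carrier → Coords k n
  coords u = tabulateᶜ (λ i → E.index i (φ u i))

  element : Coords k n → Carrier
  element τ = proj₁ (φ-surjective (λ i → E.enum i (lookupᶜ τ i)))

  φ-element : ∀ τ i → F._≈_ i (φ (element τ) i) (E.enum i (lookupᶜ τ i))
  φ-element τ = proj₂ (φ-surjective (λ i → E.enum i (lookupᶜ τ i)))

  coords-cong : ∀ {u w} → u ≈ w → coords u ≡ coords w
  coords-cong u≈w = tabulateᶜ-cong (λ i → E.index-cong i (φ-cong _ _ u≈w i))

  coords-element : ∀ τ → coords (element τ) ≡ τ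
  coords-element τ = ≡.trans
    (tabulateᶜ-cong (λ i → ≡.trans (E.index-cong i (φ-element τ i)) (E.index-enum i (lookupᶜ τ i))))
    (tabulate-lookupᶜ τ)

  element-coords : ∀ u → element (coords u) ≈ u
  element-coords u = φ-injective _ _ (λ i → F.trans i (φ-element (coords u) i)
    (F.trans i (F.reflexive i (cong (E.enum i) (lookup-tabulateᶜ _ i))) (E.enum-index i (φ u i))))

  element-injective : ∀ {σ τ} → element σ ≈ element τ → σ ≡ τ
  element-injective {σ} {τ} eq = ≡.trans (≡.sym (coords-element σ)) (≡.trans (coords-cong eq) (coords-element τ))

  φ-element≈0# : ∀ {τ} i → lookupᶜ τ i ≡ zero → VanishesAt (element τ) i
  φ-element≈0# {τ} i τᵢ≡0 = F.trans i (φ-element τ i) (F.trans i (F.reflexive i (cong (E.enum i) τᵢ≡0)) (E.enum-zero i))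

  element-≉0# : ∀ {τ} → τ ≢ 0ᶜ → ¬ element τ ≈ 0#
  element-≉0# {τ} τ≢0 eq = τ≢0 (≡.trans (≡.sym (coords-element τ)) (≡.trans (coords-cong eq) coords-0#))
    where
      coords-0# : coords 0# ≡ 0ᶜ
      coords-0# = tabulateᶜ-cong (λ i → E.index-zero i (φ-0# i))

  coords-≢0ᶜ : ∀ {u} → ¬ u ≈ 0# → coords u ≢ 0ᶜ
  coords-≢0ᶜ {u} u≉0 eq = u≉0 (trans (sym (element-coords u)) (trans (reflexive (cong element eq))
    (vanishesEverywhere⇒≈0# (λ i → φ-element≈0# i (lookup-tabulateᶜ _ i)))))

  VanishesAt? : ∀ v → Decidable (VanishesAt v)
  VanishesAt? v i = E.≈0? i (φ v i)

  supported-coordinate : ∀ {v σ} → Supported (VanishesAt v) σ → ∀ i → VanishesAt (element σ) i ⊎ VanishesAt v i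
  supported-coordinate {v} σ-sup i with VanishesAt? v i
  ... | yes vᵢ≈0 = inj₂ vᵢ≈0
  ... | no  vᵢ≉0 = inj₁ (φ-element≈0# i (σ-sup i vᵢ≉0))

  supported⇒annihilates : ∀ {v σ} → Supported (VanishesAt v) σ → element σ * v ≈ 0#
  supported⇒annihilates {v} {σ} σ-sup = vanishesEverywhere⇒≈0# λ i → F.trans i (φ-* (element σ) v i)
    ([ (λ uᵢ≈0 → F.trans i (F.*-congʳ i uᵢ≈0) (F.zeroˡ i _))
     , (λ vᵢ≈0 → F.trans i (F.*-congˡ i vᵢ≈0) (F.zeroʳ i _)) ]′ (supported-coordinate σ-sup i))

  supported-≈⇒≈0# : ∀ {v σ} → Supported (VanishesAt v) σ → element σ ≈ v → element σ ≈ 0#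
  supported-≈⇒≈0# {v} {σ} σ-sup eq = vanishesEverywhere⇒≈0# λ i →
    [ (λ uᵢ≈0 → uᵢ≈0) , F.trans i (φ-cong _ _ eq i) ]′ (supported-coordinate σ-sup i)

  annihilates⇒supported : ∀ {u v} → u * v ≈ 0# → Supported (VanishesAt v) (coords u)
  annihilates⇒supported {u} {v} uv≈0 i vᵢ≉0 =
    ≡.trans (lookup-tabulateᶜ _ i) (E.index-zero i (x*y≈0⇒x≈0 (F i) (F-isField i) uᵢvᵢ≈0 vᵢ≉0))
    where
      uᵢvᵢ≈0 : F._≈_ i (F._*_ i (φ u i) (φ v i)) (F.0# i)
      uᵢvᵢ≈0 = F.trans i (F.sym i (φ-* u v i)) (F.trans i (φ-cong _ _ uv≈0 i) (φ-0# i))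

  neighbours : Carrier → List Carrier
  neighbours v = map element (nonzeroSupported (VanishesAt? v))

  neighbours-sound : ∀ {v} → IsZeroDivisor R v → All (InNeighbourhood R v) (neighbours v)
  neighbours-sound {v} (v≉0 , _) = All.map⁺ (All.tabulate λ σ∈ →
    let σ-sup , σ≢0 = ∈-nonzeroSupported⁻ (VanishesAt? v) σ∈
        σ≉0   = element-≉0# σ≢0
        σv≈0  = supported⇒annihilates σ-sup
    in (σ≉0 , v , v≉0 , σv≈0) , σ≉0 ∘ supported-≈⇒≈0# σ-sup , σv≈0)

  neighbours-complete : ∀ {v u} → InNeighbourhood R v u → Any (u ≈_) (neighbours v)
  neighbours-complete {v} {u} ((u≉0 , _) , _ , uv≈0)
    with nonzeroSupported-complete (VanishesAt? v) (coords u) (annihilates⇒supported uv≈0)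
  ... | here  eq = ⊥-elim (coords-≢0ᶜ u≉0 eq)
  ... | there u∈ = Any.map (λ eq → trans (sym (element-coords u)) (reflexive eq)) (∈-map⁺ element u∈)

  neighbours-unique : ∀ v → AllPairs (λ x y → ¬ x ≈ y) (neighbours v)
  neighbours-unique v = Uniqueₛ.map⁺ (≡.setoid _) setoid element-injective (nonzeroSupported-unique (VanishesAt? v))

  module _ {a ℓa} (A : AbelianGroup a ℓa) (g : ∀ i → ZeroSumLabelling A (n i)) where
    private module A = AbelianGroup A
    open FirstNonzeroLabelling A.monoid
    open import Relation.Binary.Reasoning.Setoid A.setoid

    label : Carrier → A.Carrier
    label = firstNonzeroLabel (λ i → proj₁ (g i)) ∘ coords

    ∑-label-neighbours : ∀ v → ∑ label (neighbours v) A.≈ A.ε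
    ∑-label-neighbours v = begin
      ∑ label (map element σs)                    ≡⟨ ∑-map label element σs ⟩
      ∑ (label ∘ element) σs                      ≡⟨ cong (foldr A._∙_ A.ε) (map-cong (cong L ∘ coords-element) σs) ⟩
      ∑ L σs                                      ≈⟨ ∑-firstNonzeroLabel (λ i → proj₂ (proj₂ (g i))) (VanishesAt? v) ⟩
      A.ε                                         ∎
      where
        L : Coords k n → A.Carrier
        L = firstNonzeroLabel (λ i → proj₁ (g i))
        σs : List (Coords k n)
        σs = nonzeroSupported (VanishesAt? v)

    vertexMagic : IsVertexMagicZDG R A
    vertexMagic =
        label
      , (λ u w u≈w → A.reflexive (cong (firstNonzeroLabel _) (coords-cong u≈w)))
      , (λ u (u≉0 , _) → firstNonzeroLabel-≉ε (λ i → proj₁ (proj₂ (g i))) (coords u) (coords-≢0ᶜ u≉0))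
      , A.ε
      , λ v v∈Z → neighbours v , neighbours-sound v∈Z , (λ u → neighbours-complete)
                , neighbours-unique v , ∑-label-neighbours v

mainTheorem7 : ∀ {c ℓ c' ℓ' a ℓa : Level}
    (k : ℕ) → 1 ≤ k →
    (q : Fin k → ℕ) → (∀ i → IsPrimePower (q i)) → (∀ i → 3 ≤ q i) →
    (F : Fin k → CommutativeRing c' ℓ') →
    (∀ i → IsField (F i)) → (∀ i → HasCardinality (F i) (q i)) →
    (R : CommutativeRing c ℓ) →
    (∃[ φ ] IsRingIsoToProduct R F φ) →
    (A : AbelianGroup a ℓa) → MoreThanTwoElements A →
    IsVertexMagicZDG R A
mainTheorem7 k _ q _ q≥3 F F-isField F-card R (φ , φ-iso) A A>2 =
  ProductOfFields.vertexMagic F F-isField E R φ φ-iso A (λ i → zeroSumLabelling A>2 (m i))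
  where
    open ZeroSumVectors A using (zeroSumLabelling)

    3+m≡q : ∀ i → ∃[ m ] suc (suc (suc m)) ≡ q i
    3+m≡q i = m≤n⇒∃[o]m+o≡n (q≥3 i)

    m : Fin k → ℕ
    m i = proj₁ (3+m≡q i)

    E : ∀ i → ZeroFirstEnumeration (F i) (suc (suc (m i)))
    E i = zeroFirst (≡.subst (HasCardinality (F i)) (≡.sym (proj₂ (3+m≡q i))) (F-card i))
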